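{- The difference $\mathrm{gp}_{\rm d}(G)-\mathrm{gp}_{\rm d}(G-e)$ can be arbitrarily large: for every positive integer $N$ there exist a connected graph $G$ and an edge $e$ of $G$ such that $\mathrm{gp}_{\rm d}(G)-\mathrm{gp}_{\rm d}(G-e)\ge N$.
   Context: All graphs are finite, simple and connected. For a graph $G$ and $Z\subseteq V(G)$, two vertices $p,q\in V(G)$ are $Z$-positionable if no shortest $p,q$-path in $G$ has an internal vertex in $Z$. $Z$ is a dual general position set if every two vertices of $Z$ are $Z$-positionable and every two vertices of $V(G)\setminus Z$ are $Z$-positionable (the empty set qualifies). $\mathrm{gp}_{\rm d}(G)$ is the maximum cardinality of a dual general position set of $G$. $G-e$ is the graph obtained by deleting the edge $e$. -}

module Defs where

open import Data.Nat using (ℕ; zero; suc; _≤_)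
open import Data.Bool using (Bool; true; false; _∧_; _∨_; not)
open import Data.Fin using (Fin)
open import Data.Fin.Properties using (_≟_)
open import Data.Fin.Subset using (Subset; _∈_; _∉_; ∣_∣)
open import Data.List using (List; []; _∷_)
open import Data.List.Membership.Propositional using () renaming (_∈_ to _∈ᴸ_)
open import Data.Product using (Σ; _×_; ∃)
open import Relation.Binary.PropositionalEquality using (_≡_)
open import Relation.Nullary using (¬_)
open import Relation.Nullary.Decidable using (⌊_⌋)

Graph : ℕ → Set
Graph n = Fin n → Fin n → Bool

IsSimple : {n : ℕ} → Graph n → Set
IsSimple {n} G = (∀ (x y : Fin n) → G x y ≡ G y x) × (∀ (x : Fin n) → G x x ≡ false)

data Walk {n : ℕ} (G : Graph n) : Fin n → Fin n → Set where
  nil  : ∀ {p} → Walk G p p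
  cons : ∀ {p r q} → G p r ≡ true → Walk G r q → Walk G p q

len : ∀ {n} {G : Graph n} {p q} → Walk G p q → ℕ
len nil = zero
len (cons _ w) = suc (len w)

interior : ∀ {n} {G : Graph n} {p q} → Walk G p q → List (Fin n)
interior nil = []
interior (cons _ nil) = []
interior (cons {r = r} _ (cons e w)) = r ∷ interior (cons e w)

Connected : {n : ℕ} → Graph n → Set
Connected {n} G = ∀ (p q : Fin n) → Walk G p q

-- a shortest p,q-path: a walk of minimum length among all p,q-walks
-- (such a walk is necessarily a path)
IsShortest : ∀ {n} {G : Graph n} {p q} → Walk G p q → Set
IsShortest {G = G} {p} {q} w = ∀ (w' : Walk G p q) → len w ≤ len w'

Positionable : ∀ {n} → Graph n → Subset n → Fin n → Fin n → Set
Positionable G Z p q =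
  ∀ (w : Walk G p q) → IsShortest w → ∀ v → v ∈ᴸ interior w → v ∉ Z

IsDualGP : ∀ {n} → Graph n → Subset n → Set
IsDualGP {n} G Z =
  (∀ (p q : Fin n) → p ∈ Z → q ∈ Z → Positionable G Z p q) ×
  (∀ (p q : Fin n) → p ∉ Z → q ∉ Z → Positionable G Z p q)

IsGpd : ∀ {n} → Graph n → ℕ → Set
IsGpd {n} G k =
  (Σ (Subset n) λ Z → IsDualGP G Z × ∣ Z ∣ ≡ k) ×
  (∀ (Z : Subset n) → IsDualGP G Z → ∣ Z ∣ ≤ k)

deleteEdge : ∀ {n} → Graph n → Fin n → Fin n → Graph n
deleteEdge G u v x y =
  G x y ∧ not ((⌊ x ≟ u ⌋ ∧ ⌊ y ≟ v ⌋) ∨ (⌊ x ≟ v ⌋ ∧ ⌊ y ≟ u ⌋))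

{-# OPTIONS --safe #-}
-- The triangular book Bₘ = K₂ ∨ K̄ₘ (m triangles sharing the spine edge) has
-- gp_d(Bₘ) = m, attained by the pages, while removing the spine leaves K₂,ₘ
-- with gp_d = 0. Both graphs have diameter 2, so positionability only concerns
-- midpoints of induced 2-paths. For m ≥ 3 a spine vertex is the midpoint of three
-- pairwise non-adjacent pages, two of which lie on the same side of any Z, so it
-- is never in a dual general position set; in K₂,ₘ every page is moreover the
-- midpoint of the two (now non-adjacent) spine vertices.
module Submission where

open import Defs
open import Data.Nat using (ℕ; _≤_; _+_; z≤n; s≤s)
open import Data.Nat.Properties using (≤-refl; ≤-trans; m≤n+m)
open import Data.Bool using (true; false)
open import Data.Bool.Properties using (¬-not)
open import Data.Fin using (Fin; zero; suc; _↑ˡ_; _↑ʳ_)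
open import Data.Fin.Properties using (suc-injective)
open import Data.Fin.Subset using (Subset; _∈_; _∉_; _⊆_; ∣_∣; ⊤; ⊥; outside)
open import Data.Fin.Subset.Properties using (_∈?_; ∈⊤; ∉⊥; ∣⊤∣≡n; ∣⊥∣≡0; p⊆q⇒∣p∣≤∣q∣)
open import Data.Vec using (_∷_; _[_]=_)
open _[_]=_ using () renaming (there to thereᵛ)
open import Data.List.Relation.Unary.Any using (here)
open import Data.List.Membership.Propositional using () renaming (_∈_ to _∈ᴸ_)
open import Data.Product using (Σ; _×_; _,_)
open import Data.Sum using (_⊎_; inj₁; inj₂)
open import Data.Empty using (⊥-elim)
open import Relation.Nullary using (¬_; yes; no)
open import Relation.Binary.PropositionalEquality using (_≡_; _≢_; refl; subst)

private
  variable
    n : ℕ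
    G : Graph n
    Z : Subset n
    p q v : Fin n

data Dist≤2 (G : Graph n) : Fin n → Fin n → Set where
  dist₀ : Dist≤2 G p p
  dist₁ : G p q ≡ true → Dist≤2 G p q
  dist₂ : ∀ r → G p r ≡ true → G r q ≡ true → Dist≤2 G p q

Diameter≤2 : Graph n → Set
Diameter≤2 G = ∀ p q → Dist≤2 G p q

-- v is the inner vertex of a shortest p,q-path of length 2
Midpoint : Graph n → Fin n → Fin n → Fin n → Set
Midpoint G p v q = G p v ≡ true × G v q ≡ true × G p q ≡ false × p ≢ q

dist≤2⇒walk : Dist≤2 G p q → Walk G p q
dist≤2⇒walk dist₀             = nil
dist≤2⇒walk (dist₁ pq)        = cons pq nil
dist≤2⇒walk (dist₂ _ pr rq)   = cons pr (cons rq nil)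

len-dist≤2⇒walk : (d : Dist≤2 G p q) → len (dist≤2⇒walk d) ≤ 2
len-dist≤2⇒walk dist₀         = z≤n
len-dist≤2⇒walk (dist₁ _)     = s≤s z≤n
len-dist≤2⇒walk (dist₂ _ _ _) = ≤-refl

diameter≤2⇒connected : Diameter≤2 G → Connected G
diameter≤2⇒connected diam p q = dist≤2⇒walk (diam p q)

shortest-len≤2 : Dist≤2 G p q → (w : Walk G p q) → IsShortest w → len w ≤ 2
shortest-len≤2 d w shortest = ≤-trans (shortest (dist≤2⇒walk d)) (len-dist≤2⇒walk d)

shortest-interior-midpoint : Dist≤2 G p q → (w : Walk G p q) → IsShortest w →
                             v ∈ᴸ interior w → Midpoint G p v q
shortest-interior-midpoint d (cons _ nil) _ ()
shortest-interior-midpoint d (cons pv (cons vq nil)) shortest (here refl) =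
  pv , vq , ¬-not (λ pq → 2≰1 (shortest (cons pq nil))) , λ { refl → 2≰0 (shortest nil) }
  where
    2≰1 : ¬ (2 ≤ 1)
    2≰1 (s≤s ())
    2≰0 : ¬ (2 ≤ 0)
    2≰0 ()
shortest-interior-midpoint d w@(cons _ (cons _ (cons _ _))) shortest _
  with shortest-len≤2 d w shortest
... | s≤s (s≤s ())

positionable⇒midpoint∉ : Positionable G Z p q → Midpoint G p v q → v ∉ Z
positionable⇒midpoint∉ {v = v} pos (pv , vq , p≁q , p≢q) =
  pos (cons pv (cons vq nil)) shortest v (here refl)
  where
    shortest : IsShortest (cons pv (cons vq nil))
    shortest nil = ⊥-elim (p≢q refl)
    shortest (cons pq nil) with subst (_≡ true) p≁q pq
    ... | ()
    shortest (cons _ (cons _ _)) = s≤s (s≤s z≤n)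

midpoints∉⇒positionable : Dist≤2 G p q → (∀ {v} → Midpoint G p v q → v ∉ Z) →
                          Positionable G Z p q
midpoints∉⇒positionable d mid∉ w shortest v v∈w =
  mid∉ (shortest-interior-midpoint d w shortest v∈w)

SameSide : Subset n → Fin n → Fin n → Set
SameSide Z p q = (p ∈ Z × q ∈ Z) ⊎ (p ∉ Z × q ∉ Z)

sameSide-pigeonhole : ∀ (Z : Subset n) a b c → SameSide Z a b ⊎ SameSide Z a c ⊎ SameSide Z b c
sameSide-pigeonhole Z a b c with a ∈? Z | b ∈? Z | c ∈? Z
... | yes a∈ | yes b∈ | _      = inj₁ (inj₁ (a∈ , b∈))
... | no  a∉ | no  b∉ | _      = inj₁ (inj₂ (a∉ , b∉))
... | yes a∈ | no  _  | yes c∈ = inj₂ (inj₁ (inj₁ (a∈ , c∈)))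
... | no  a∉ | yes _  | no  c∉ = inj₂ (inj₁ (inj₂ (a∉ , c∉)))
... | yes _  | no  b∉ | no  c∉ = inj₂ (inj₂ (inj₂ (b∉ , c∉)))
... | no  _  | yes b∈ | yes c∈ = inj₂ (inj₂ (inj₁ (b∈ , c∈)))

isDualGP⇒positionable : IsDualGP G Z → SameSide Z p q → Positionable G Z p q
isDualGP⇒positionable (inZ , _)  (inj₁ (p∈ , q∈)) = inZ _ _ p∈ q∈
isDualGP⇒positionable (_ , outZ) (inj₂ (p∉ , q∉)) = outZ _ _ p∉ q∉

isDualGP⇒midpoint∉ : IsDualGP G Z → SameSide Z p q → Midpoint G p v q → v ∉ Z
isDualGP⇒midpoint∉ dual same = positionable⇒midpoint∉ (isDualGP⇒positionable dual same)

isDualGP⇒common-midpoint∉ : ∀ {a b c} → IsDualGP G Z →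
  Midpoint G a v b → Midpoint G a v c → Midpoint G b v c → v ∉ Z
isDualGP⇒common-midpoint∉ {Z = Z} {a = a} {b} {c} dual ab ac bc
  with sameSide-pigeonhole Z a b c
... | inj₁ same        = isDualGP⇒midpoint∉ dual same ab
... | inj₂ (inj₁ same) = isDualGP⇒midpoint∉ dual same ac
... | inj₂ (inj₂ same) = isDualGP⇒midpoint∉ dual same bc

positionable⇒isDualGP : (∀ p q → Positionable G Z p q) → IsDualGP G Z
positionable⇒isDualGP pos = (λ p q _ _ → pos p q) , (λ p q _ _ → pos p q)

⊥-isDualGP : IsDualGP G ⊥
⊥-isDualGP = positionable⇒isDualGP λ _ _ _ _ _ _ → ∉⊥

module _ {m : ℕ} where

  spine : Fin 2 → Fin (2 + m)
  spine s = s ↑ˡ m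

  page : Fin m → Fin (2 + m)
  page i = 2 ↑ʳ i

  pages : Subset (2 + m)
  pages = outside ∷ outside ∷ ⊤

book : (m : ℕ) → Graph (2 + m)
book m zero          zero          = false
book m zero          (suc _)       = true
book m (suc zero)    zero          = true
book m (suc zero)    (suc zero)    = false
book m (suc zero)    (suc (suc _)) = true
book m (suc (suc _)) zero          = true
book m (suc (suc _)) (suc zero)    = true
book m (suc (suc _)) (suc (suc _)) = false

spineless : (m : ℕ) → Graph (2 + m)
spineless m = deleteEdge (book m) (spine zero) (spine (suc zero))

book-isSimple : ∀ m → IsSimple (book m)
book-isSimple m = symmetric , irreflexive
  where
    symmetric : ∀ x y → book m x y ≡ book m y x
    symmetric zero          zero          = refl
    symmetric zero          (suc zero)    = refl
    symmetric zero          (suc (suc _)) = refl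
    symmetric (suc zero)    zero          = refl
    symmetric (suc zero)    (suc zero)    = refl
    symmetric (suc zero)    (suc (suc _)) = refl
    symmetric (suc (suc _)) zero          = refl
    symmetric (suc (suc _)) (suc zero)    = refl
    symmetric (suc (suc _)) (suc (suc _)) = refl
    irreflexive : ∀ x → book m x x ≡ false
    irreflexive zero          = refl
    irreflexive (suc zero)    = refl
    irreflexive (suc (suc _)) = refl

book-diameter≤2 : ∀ m → Diameter≤2 (book m)
book-diameter≤2 m zero          zero          = dist₀
book-diameter≤2 m zero          (suc _)       = dist₁ refl
book-diameter≤2 m (suc zero)    zero          = dist₁ refl
book-diameter≤2 m (suc zero)    (suc zero)    = dist₀
book-diameter≤2 m (suc zero)    (suc (suc _)) = dist₁ refl
book-diameter≤2 m (suc (suc _)) zero          = dist₁ refl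
book-diameter≤2 m (suc (suc _)) (suc zero)    = dist₁ refl
book-diameter≤2 m (suc (suc _)) (suc (suc _)) = dist₂ zero refl refl

spineless-diameter≤2 : ∀ m → Diameter≤2 (spineless (1 + m))
spineless-diameter≤2 m zero          zero          = dist₀
spineless-diameter≤2 m zero          (suc zero)    = dist₂ (page zero) refl refl
spineless-diameter≤2 m zero          (suc (suc _)) = dist₁ refl
spineless-diameter≤2 m (suc zero)    zero          = dist₂ (page zero) refl refl
spineless-diameter≤2 m (suc zero)    (suc zero)    = dist₀
spineless-diameter≤2 m (suc zero)    (suc (suc _)) = dist₁ refl
spineless-diameter≤2 m (suc (suc _)) zero          = dist₁ refl
spineless-diameter≤2 m (suc (suc _)) (suc zero)    = dist₁ refl
spineless-diameter≤2 m (suc (suc _)) (suc (suc _)) = dist₂ zero refl refl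

book-midpoint∉pages : ∀ {m} {p q v : Fin (2 + m)} → Midpoint (book m) p v q → v ∉ pages
book-midpoint∉pages {v = zero}       _ ()
book-midpoint∉pages {v = suc zero}   _ (thereᵛ ())
book-midpoint∉pages {p = zero}        {zero}        {suc (suc _)} (_ , _ , _ , p≢q) = ⊥-elim (p≢q refl)
book-midpoint∉pages {p = suc zero}    {suc zero}    {suc (suc _)} (_ , _ , _ , p≢q) = ⊥-elim (p≢q refl)
book-midpoint∉pages {p = zero}        {suc zero}    {suc (suc _)} (_ , _ , () , _)
book-midpoint∉pages {p = suc zero}    {zero}        {suc (suc _)} (_ , _ , () , _)
book-midpoint∉pages {p = suc (suc _)} {_}           {suc (suc _)} (() , _)
book-midpoint∉pages {p = zero}        {suc (suc _)} {suc (suc _)} (_ , () , _)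
book-midpoint∉pages {p = suc zero}    {suc (suc _)} {suc (suc _)} (_ , () , _)

pages-isDualGP : ∀ m → IsDualGP (book m) pages
pages-isDualGP m = positionable⇒isDualGP λ p q →
  midpoints∉⇒positionable (book-diameter≤2 m p q) book-midpoint∉pages

PagesMeetAtSpine : ∀ {m} → Graph (2 + m) → Set
PagesMeetAtSpine {m} G = ∀ s {i j : Fin m} → i ≢ j → Midpoint G (page i) (spine s) (page j)

page-injective : ∀ {m} {i j : Fin m} → page {m} i ≡ page j → i ≡ j
page-injective eq = suc-injective (suc-injective eq)

book-pagesMeetAtSpine : ∀ m → PagesMeetAtSpine (book m)
book-pagesMeetAtSpine m zero       i≢j = refl , refl , refl , λ eq → i≢j (page-injective eq)
book-pagesMeetAtSpine m (suc zero) i≢j = refl , refl , refl , λ eq → i≢j (page-injective eq)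

spineless-pagesMeetAtSpine : ∀ m → PagesMeetAtSpine (spineless m)
spineless-pagesMeetAtSpine m zero       i≢j = refl , refl , refl , λ eq → i≢j (page-injective eq)
spineless-pagesMeetAtSpine m (suc zero) i≢j = refl , refl , refl , λ eq → i≢j (page-injective eq)

isDualGP⇒spine∉ : ∀ {k} {G : Graph (5 + k)} {Z} → PagesMeetAtSpine G → IsDualGP G Z →
                  ∀ s → spine s ∉ Z
isDualGP⇒spine∉ meet dual s =
  isDualGP⇒common-midpoint∉ {a = page zero} {page (suc zero)} {page (suc (suc zero))} dual
    (meet s λ ()) (meet s λ ()) (meet s λ ())

spine∉⇒⊆pages : ∀ {m} {Z : Subset (2 + m)} → (∀ s → spine s ∉ Z) → Z ⊆ pages
spine∉⇒⊆pages spine∉ {zero}        x∈Z = ⊥-elim (spine∉ zero x∈Z)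
spine∉⇒⊆pages spine∉ {suc zero}    x∈Z = ⊥-elim (spine∉ (suc zero) x∈Z)
spine∉⇒⊆pages spine∉ {suc (suc _)} _   = thereᵛ (thereᵛ ∈⊤)

spineless-page∉ : ∀ {m} {Z : Subset (2 + m)} → IsDualGP (spineless m) Z →
                  (∀ s → spine s ∉ Z) → ∀ i → page i ∉ Z
spineless-page∉ dual spine∉ i =
  isDualGP⇒midpoint∉ dual (inj₂ (spine∉ zero , spine∉ (suc zero))) (refl , refl , refl , λ ())

gpd-book : ∀ k → IsGpd (book (3 + k)) (3 + k)
gpd-book k = (pages , pages-isDualGP _ , ∣⊤∣≡n _) , maximal
  where
    maximal : ∀ Z → IsDualGP (book (3 + k)) Z → ∣ Z ∣ ≤ 3 + k
    maximal Z dual = subst (∣ Z ∣ ≤_) (∣⊤∣≡n _) (p⊆q⇒∣p∣≤∣q∣ (spine∉⇒⊆pages spine∉))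
      where
        spine∉ : ∀ s → spine s ∉ Z
        spine∉ = isDualGP⇒spine∉ (book-pagesMeetAtSpine _) dual

gpd-spineless : ∀ k → IsGpd (spineless (3 + k)) 0
gpd-spineless k = (⊥ , ⊥-isDualGP , ∣⊥∣≡0 (5 + k)) , maximal
  where
    maximal : ∀ Z → IsDualGP (spineless (3 + k)) Z → ∣ Z ∣ ≤ 0
    maximal Z dual =
      subst (∣ Z ∣ ≤_) (∣⊥∣≡0 (5 + k)) (p⊆q⇒∣p∣≤∣q∣ {q = ⊥} λ {x} x∈Z → ⊥-elim (∉Z x x∈Z))
      where
        spine∉ : ∀ s → spine s ∉ Z
        spine∉ = isDualGP⇒spine∉ (spineless-pagesMeetAtSpine _) dual
        ∉Z : ∀ x → x ∉ Z
        ∉Z zero          = spine∉ zero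
        ∉Z (suc zero)    = spine∉ (suc zero)
        ∉Z (suc (suc i)) = spineless-page∉ dual spine∉ i

theorem4p3 : ∀ (N : ℕ) → 1 ≤ N →
    Σ ℕ λ n → Σ (Graph n) λ G → Σ (Fin n) λ u → Σ (Fin n) λ v →
    Σ ℕ λ a → Σ ℕ λ b →
      IsSimple G × Connected G × G u v ≡ true ×
      Connected (deleteEdge G u v) ×
      IsGpd G a × IsGpd (deleteEdge G u v) b × b + N ≤ a
theorem4p3 N _ =
  5 + N , book (3 + N) , spine zero , spine (suc zero) , 3 + N , 0 ,
  book-isSimple _ ,
  diameter≤2⇒connected (book-diameter≤2 _) ,
  refl ,
  diameter≤2⇒connected (spineless-diameter≤2 _) ,
  gpd-book N ,
  gpd-spineless N ,
  m≤n+m N 3
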